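{- Let $a\ge1$ be an integer. If an infinite word has pseudoperiod $(a,2a)$, then it has critical exponent $\infty$.
   Context: An infinite word $\mathbf{x}$ over a finite alphabet (indexed from $0$) has pseudoperiod $(a,2a)$ if $\mathbf{x}[i]\in\{\mathbf{x}[i+a],\mathbf{x}[i+2a]\}$ for all $i\ge0$. The exponent of a nonempty finite word $y$ is $|y|/p$ where $p$ is the smallest period of $y$; the critical exponent of an infinite word is the supremum of the exponents of all its nonempty finite factors. -}

module Defs where

open import Data.Nat using (ℕ; _+_; _*_; _<_; _≤_; _>_)
open import Data.Fin using (Fin)
open import Data.Product using (Σ; ∃; _×_)
open import Data.Sum using (_⊎_)
open import Relation.Binary.PropositionalEquality using (_≡_)

Word : ℕ → Set
Word m = ℕ → Fin m

HasPseudoperiod : ∀ {m} → Word m → ℕ → ℕ → Set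
HasPseudoperiod x a b = ∀ i → (x i ≡ x (i + a)) ⊎ (x i ≡ x (i + b))

IsPeriodOfFactor : ∀ {m} → Word m → (i n p : ℕ) → Set
IsPeriodOfFactor x i n p =
  (1 ≤ p) × (p ≤ n) × (∀ j → j + p < n → x (i + j) ≡ x (i + j + p))

IsSmallestPeriodOfFactor : ∀ {m} → Word m → (i n p : ℕ) → Set
IsSmallestPeriodOfFactor x i n p =
  IsPeriodOfFactor x i n p × (∀ q → IsPeriodOfFactor x i n q → p ≤ q)

-- The nonempty factor x[i .. i+n-1] has exponent n/p strictly greater than k,
-- i.e. n > k * p where p is its smallest period.
FactorExponentExceeds : ∀ {m} → Word m → (i n k : ℕ) → Set
FactorExponentExceeds x i n k =
  (1 ≤ n) × Σ ℕ (λ p → IsSmallestPeriodOfFactor x i n p × (n > k * p))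

CriticalExponentInfinite : ∀ {m} → Word m → Set
CriticalExponentInfinite x =
  ∀ k → Σ ℕ (λ i → Σ ℕ (λ n → FactorExponentExceeds x i n k))

{-# OPTIONS --safe #-}
-- If x i ≢ x (i + 2a), the pseudoperiod forces x i ≡ x (i + a) and x (i + a) ≢ x (i + 2a).
-- A mismatch x j ≢ x (j + a) in turn forces x j ≡ x (j + 2a) and x (j + a) ≢ x (j + 2a),
-- so it propagates along j + a ℕ. Hence along every progression i + a ℕ the equation
-- x i ≡ x (i + 2a) fails at most once, so x has period 2a on arbitrarily long factors,
-- whose exponents are then unbounded.
module Submission where

open import Defs
open import Data.Nat using (ℕ; _*_; _≤_; suc; _+_; _<_; _≤?_; _<?_; NonZero; >-nonZero)
open import Data.Nat.Properties
open import Data.Nat.DivMod using (_/_; _%_; m≡m%n+[m/n]*n; m%n<n; m/n≤m)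
open import Data.Nat.Induction using (<-rec)
open import Data.Nat.Tactic.RingSolver using (solve-∀)
import Data.Fin.Properties as Fin
open import Data.Product using (∃-syntax; _×_; _,_; proj₁; proj₂)
open import Data.Sum using (inj₁; inj₂)
open import Function using (_∘_)
open import Relation.Nullary using (¬_; Dec; yes; no; ¬?; contradiction)
open import Relation.Nullary.Decidable using (_×-dec_; _→-dec_; map′; decidable-stable)
open import Relation.Unary using (Decidable)
open import Relation.Binary.PropositionalEquality

module _ {P : ℕ → Set} (P? : Decidable P) where

  minimal-witness : ∀ p → P p → ∃[ q ] P q × q ≤ p × (∀ q′ → P q′ → q ≤ q′)
  minimal-witness = <-rec _ search
    where
    search : ∀ p → (∀ {q} → q < p → P q → ∃[ r ] P r × r ≤ q × (∀ q′ → P q′ → r ≤ q′)) →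
             P p → ∃[ q ] P q × q ≤ p × (∀ q′ → P q′ → q ≤ q′)
    search p below Pp with anyUpTo? P? p
    ... | yes (q , q<p , Pq) =
      let r , Pr , r≤q , r-min = below q<p Pq in r , Pr , ≤-trans r≤q (<⇒≤ q<p) , r-min
    ... | no none = p , Pp , ≤-refl , λ q Pq → ≮⇒≥ (λ q<p → none (q , q<p , Pq))

module _ {m : ℕ} (x : Word m) where

  isPeriodOfFactor? : ∀ i n p → Dec (IsPeriodOfFactor x i n p)
  isPeriodOfFactor? i n p = 1 ≤? p ×-dec p ≤? n ×-dec map′ fromBounded toBounded repeats?
    where
    Repeats : ℕ → Set
    Repeats j = j + p < n → x (i + j) ≡ x (i + j + p)
    repeats? : Dec (∀ {j} → j < n → Repeats j)
    repeats? = allUpTo? (λ j → (j + p <? n) →-dec (x (i + j) Fin.≟ x (i + j + p))) n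
    fromBounded : (∀ {j} → j < n → Repeats j) → ∀ j → Repeats j
    fromBounded rep j j+p<n = rep (≤-<-trans (m≤m+n j p) j+p<n) j+p<n
    toBounded : (∀ j → Repeats j) → ∀ {j} → j < n → Repeats j
    toBounded rep {j} _ = rep j

  period⇒exponentExceeds : ∀ {i n k p} → IsPeriodOfFactor x i n p → k * p < n →
                           FactorExponentExceeds x i n k
  period⇒exponentExceeds {i} {n} {k} {p} per@(1≤p , p≤n , _) kp<n
    with minimal-witness (isPeriodOfFactor? i n) p per
  ... | q , per-q , q≤p , q-min =
    ≤-trans 1≤p p≤n , q , (per-q , q-min) , ≤-<-trans (*-monoʳ-≤ k q≤p) kp<n

  Matches : ℕ → ℕ → Set
  Matches d i = x i ≡ x (i + d)

  matches? : ∀ d i → Dec (Matches d i)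
  matches? d i = x i Fin.≟ x (i + d)

  run⇒period : ∀ {i n p} → 1 ≤ p → p ≤ n → (∀ j → j < n → Matches p (i + j)) →
               IsPeriodOfFactor x i n p
  run⇒period {p = p} 1≤p p≤n run = 1≤p , p≤n , λ j j+p<n → run j (≤-<-trans (m≤m+n j p) j+p<n)

-- Constructive replacement for "each progression i + a ℕ fails G at most once": G is
-- established on a grid s + (r + t a), r < c, t < L, one residue column r at a time,
-- moving the grid past the first failure in the new column.
module Grids {G : ℕ → Set} (G? : Decidable G) (a : ℕ)
             (recovers : ∀ i → ¬ G i → ∀ t → G (i + suc t * a)) where

  record Grid (s c L : ℕ) : Set where
    constructor mkGrid
    field holds : ∀ r t → r < c → t < L → G (s + (r + t * a))
  open Grid

  grid-shrink : ∀ {s c L L′} → L′ ≤ L → Grid s c L → Grid s c L′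
  grid-shrink L′≤L grid = mkGrid λ r t r<c t<L′ → holds grid r t r<c (≤-trans t<L′ L′≤L)

  grid-shift : ∀ {s c L} u → Grid s c (u + L) → Grid (s + u * a) c L
  grid-shift {s} u grid = mkGrid λ r t r<c t<L →
    subst G (shift-eq s u r t a) (holds grid r (u + t) r<c (+-monoʳ-< u t<L))
    where
    shift-eq : ∀ s u r t a → s + (r + (u + t) * a) ≡ s + u * a + (r + t * a)
    shift-eq = solve-∀

  grid-extend : ∀ {s c L} → Grid s c L → (∀ t → t < L → G (s + (c + t * a))) →
                Grid s (suc c) L
  grid-extend {s} {c} {L} grid column = mkGrid extended
    where
    extended : ∀ r t → r < suc c → t < L → G (s + (r + t * a))
    extended r t r<1+c t<L with m<1+n⇒m<n∨m≡n r<1+c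
    ... | inj₁ r<c = holds grid r t r<c t<L
    ... | inj₂ refl = column t t<L

  grid-step : ∀ {s c L} → Grid s c (L + L) → ∃[ s′ ] Grid s′ (suc c) L
  grid-step {s} {c} {L} grid with anyUpTo? (λ t → ¬? (G? (s + (c + t * a)))) L
  ... | no none =
    s , grid-extend (grid-shrink (m≤m+n L L) grid)
                    (λ t t<L → decidable-stable (G? _) (λ ¬G → none (t , t<L , ¬G)))
  ... | yes (t₀ , t₀<L , ¬G) =
    s + suc t₀ * a ,
    grid-extend (grid-shift (suc t₀) (grid-shrink (+-monoˡ-≤ L t₀<L) grid))
                (λ t _ → subst G (restart-eq s c t₀ t a) (recovers _ ¬G t))
    where
    restart-eq : ∀ s c t₀ t a → s + (c + t₀ * a) + suc t * a ≡ s + suc t₀ * a + (c + t * a)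
    restart-eq = solve-∀

  grid : ∀ c L → ∃[ s ] Grid s c L
  grid 0 L = 0 , mkGrid λ _ _ ()
  grid (suc c) L = grid-step (proj₂ (grid c (L + L)))

  long-runs : .{{NonZero a}} → ∀ n → ∃[ s ] (∀ j → j < n → G (s + j))
  long-runs n = s , λ j j<n →
    subst (G ∘ (s +_)) (sym (m≡m%n+[m/n]*n j a))
          (grid-a (j % a) (j / a) (m%n<n j a) (≤-<-trans (m/n≤m j a) j<n))
    where
    s : ℕ
    s = proj₁ (grid a n)
    grid-a : ∀ r t → r < a → t < n → G (s + (r + t * a))
    grid-a = holds (proj₂ (grid a n))

module Pseudoperiodic {m : ℕ} (x : Word m) (a : ℕ) (pseudo : HasPseudoperiod x a (2 * a)) where

  a+a≡2a : ∀ j → j + a + a ≡ j + 2 * a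
  a+a≡2a j = trans (+-assoc j a a) (cong (λ d → j + (a + d)) (sym (+-identityʳ a)))

  mismatch-step : ∀ {j} → ¬ Matches x a j → Matches x (2 * a) j × ¬ Matches x a (j + a)
  mismatch-step {j} ¬match with pseudo j
  ... | inj₁ match = contradiction match ¬match
  ... | inj₂ match₂ =
    match₂ , λ match → ¬match (trans match₂ (trans (cong x (sym (a+a≡2a j))) (sym match)))

  mismatch-persists : ∀ {j} → ¬ Matches x a j → ∀ t → ¬ Matches x a (j + t * a)
  mismatch-persists {j} ¬match 0 = subst (¬_ ∘ Matches x a) (sym (+-identityʳ j)) ¬match
  mismatch-persists {j} ¬match (suc t) =
    subst (¬_ ∘ Matches x a) (step-eq j t a) (proj₂ (mismatch-step (mismatch-persists ¬match t)))
    where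
    step-eq : ∀ j t a → j + t * a + a ≡ j + suc t * a
    step-eq = solve-∀

  mismatch₂-recovers : ∀ i → ¬ Matches x (2 * a) i → ∀ t → Matches x (2 * a) (i + suc t * a)
  mismatch₂-recovers i ¬match₂ t with pseudo i
  ... | inj₂ match₂ = contradiction match₂ ¬match₂
  ... | inj₁ match =
    subst (Matches x (2 * a)) (+-assoc i a (t * a))
          (proj₁ (mismatch-step (mismatch-persists ¬match-next t)))
    where
    ¬match-next : ¬ Matches x a (i + a)
    ¬match-next match′ = ¬match₂ (trans match (trans match′ (cong x (a+a≡2a i))))

proposition31 : (m a : ℕ) → 1 ≤ a → (x : Word m) →
    HasPseudoperiod x a (2 * a) → CriticalExponentInfinite x
proposition31 m a 1≤a x pseudo k =
  s , n , period⇒exponentExceeds x {k = k} (run⇒period x 1≤2a (m≤m+n (2 * a) _) run)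
                                   (m<n+m (k * (2 * a)) 1≤2a)
  where
  instance
    a≢0 : NonZero a
    a≢0 = >-nonZero 1≤a
  open Pseudoperiodic x a pseudo
  open Grids (matches? x (2 * a)) a mismatch₂-recovers
  1≤2a : 1 ≤ 2 * a
  1≤2a = ≤-trans 1≤a (m≤n*m a 2)
  n : ℕ
  n = suc k * (2 * a)
  s : ℕ
  s = proj₁ (long-runs n)
  run : ∀ j → j < n → Matches x (2 * a) (s + j)
  run = proj₂ (long-runs n)
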